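{- Fix a structural dominance $\operatorname{D}$ and let $\operatorname{d}(X):=\lVert\operatorname{D}(X)\rVert$. If countable choice holds, then for any $f:\mathbb N\to\mathcal L(\mathbb N)$, $f$ is $\operatorname{D}$-disciplined if and only if $\operatorname{d}(\operatorname{defined}(f(n)))$ holds for all $n:\mathbb N$. In particular, countable choice implies that $f:\mathbb N\to\mathcal L(\mathbb N)$ is Rosolini-disciplined (i.e. $\operatorname{D}=\operatorname{rosoliniStructure}$) if and only if $f$ factors through a Rosolini partial function, i.e. $f=i\circ g$ for some $g:\mathbb N\to\mathcal L_{\operatorname{isRosolini}}(\mathbb N)$, where $i$ is the canonical inclusion.
   Context: Type theory: Martin-Löf type theory with universe $\mathcal U$, function extensionality, proposition extensionality and propositional truncations. $\mathcal L(Y):=\sum_{P:\mathcal U}\operatorname{isProp}(P)\times(P\to Y)$ with components $\operatorname{defined}$, $\operatorname{value}$. A structural dominance is $\operatorname{D}:\mathcal U\to\mathcal U$ with maps $\operatorname{D}(X)\to\operatorname{isProp}(X)$, an element of $\operatorname{D}(1)$, and closure $\operatorname{D}(P)\to(\prod_{p:P}\operatorname{D}(Q(p)))\to\operatorname{D}(\sum_{p:P}Q(p))$ for $Q:P\to\mathcal U$. $\mathcal L_{\operatorname{D}}(Y):=\sum_{P:\mathcal U}\operatorname{D}(P)\times(P\to Y)$; $\operatorname{tame}(f'):=e\circ f'$ where $e(P,d,\varphi)=(P,-,\varphi)$; $f$ is $\operatorname{D}$-disciplined if $\lVert\sum_{f':X\to\mathcal L_{\operatorname{D}}(Y)}\operatorname{tame}(f')=f\rVert$.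 For $\alpha:\mathbb N\to2$, $\langle\alpha\rangle:=\sum_n(\alpha_n=1)$; $\mathbb N_\infty:=\sum_\alpha\operatorname{isProp}\langle\alpha\rangle$; $\operatorname{rosoliniStructure}(P):=\sum_{u:\mathbb N_\infty}(P=\langle u\rangle)$ (a structural dominance); $\operatorname{isRosolini}(P):=\lVert\operatorname{rosoliniStructure}(P)\rVert$; $\mathcal L_{\operatorname{isRosolini}}(Y):=\sum_{P}\operatorname{isRosolini}(P)\times(P\to Y)$ with inclusion $i(P,r,\varphi)=(P,-,\varphi)$ into $\mathcal L(Y)$. Countable choice: for every $Y:\mathbb N\to\mathcal U$, $(\prod_n\lVert Y(n)\rVert)\to\lVert\prod_n Y(n)\rVert$. -}

module Defs where

open import Level using (Level; _⊔_; Setω) renaming (suc to lsuc; zero to lzero)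
open import Data.Nat using (ℕ)
open import Data.Bool using (Bool; true)
open import Data.Unit using (⊤)
open import Data.Product using (Σ; _×_; _,_; proj₁; proj₂)
open import Relation.Binary.PropositionalEquality using (_≡_; refl; subst; sym; trans; trans-symˡ)
open import Function using (_∘_)

isProp : ∀ {ℓ} → Set ℓ → Set ℓ
isProp A = (x y : A) → x ≡ y

Funext : Setω
Funext = ∀ {a b} {A : Set a} {B : A → Set b} {f g : (x : A) → B x}
       → ((x : A) → f x ≡ g x) → f ≡ g

PropExt : Set₁
PropExt = {P Q : Set} → isProp P → isProp Q → (P → Q) → (Q → P) → P ≡ Q

record PropTrunc : Setω where
  field
    ∥_∥       : ∀ {ℓ} → Set ℓ → Set ℓ
    ∣_∣       : ∀ {ℓ} {A : Set ℓ} → A → ∥ A ∥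
    ∥∥-isProp : ∀ {ℓ} {A : Set ℓ} → isProp ∥ A ∥
    ∥∥-rec    : ∀ {ℓ ℓ'} {A : Set ℓ} {B : Set ℓ'} → isProp B → (A → B) → ∥ A ∥ → B

CountableChoice : PropTrunc → Set₁
CountableChoice pt = (Y : ℕ → Set) → ((n : ℕ) → ∥ Y n ∥) → ∥ ((n : ℕ) → Y n) ∥
  where open PropTrunc pt

𝓛 : Set → Set₁
𝓛 Y = Σ Set (λ P → isProp P × (P → Y))

defined : ∀ {Y} → 𝓛 Y → Set
defined = proj₁

value : ∀ {Y} → (l : 𝓛 Y) → defined l → Y
value l = proj₂ (proj₂ l)

record StructuralDominance : Set₁ where
  field
    D        : Set → Set
    D-isProp : (X : Set) → D X → isProp X
    D-unit   : D ⊤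
    D-Σ      : {P : Set} {Q : P → Set} → D P → ((p : P) → D (Q p)) → D (Σ P Q)

-- Lifting and disciplinedness relative to any family D with a map D X → isProp X
-- (level-polymorphic so that it also applies to rosoliniStructure, which lives in Set₁).
module _ {ℓ} (D : Set → Set ℓ) (D-isProp : (X : Set) → D X → isProp X) where

  𝓛D : Set → Set (lsuc lzero ⊔ ℓ)
  𝓛D Y = Σ Set (λ P → D P × (P → Y))

  e : ∀ {Y} → 𝓛D Y → 𝓛 Y
  e (P , d , φ) = (P , D-isProp P d , φ)

  tame : ∀ {X Y : Set} → (X → 𝓛D Y) → (X → 𝓛 Y)
  tame f' = e ∘ f'

  disciplined : PropTrunc → {X Y : Set} → (X → 𝓛 Y) → Set (lsuc lzero ⊔ ℓ)
  disciplined pt {X} {Y} f = ∥ Σ (X → 𝓛D Y) (λ f' → tame f' ≡ f) ∥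
    where open PropTrunc pt

⟨_⟩ : (ℕ → Bool) → Set
⟨ α ⟩ = Σ ℕ (λ n → α n ≡ true)

ℕ∞ : Set
ℕ∞ = Σ (ℕ → Bool) (λ α → isProp ⟨ α ⟩)

rosoliniStructure : Set → Set₁
rosoliniStructure P = Σ ℕ∞ (λ u → P ≡ ⟨ proj₁ u ⟩)

rosoliniStructure-isProp : (P : Set) → rosoliniStructure P → isProp P
rosoliniStructure-isProp P (u , eq) = subst isProp (sym eq) (proj₂ u)

isRosolini : PropTrunc → Set → Set₁
isRosolini pt P = ∥ rosoliniStructure P ∥
  where open PropTrunc pt

𝓛isRosolini : PropTrunc → Set → Set₁
𝓛isRosolini pt Y = Σ Set (λ P → isRosolini pt P × (P → Y))

isProp-isProp : Funext → ∀ {ℓ} {A : Set ℓ} → isProp (isProp A)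
isProp-isProp fe {A = A} p q = fe λ x → fe λ y → lemma x y (p x y) (q x y)
  where
    canon : (x : A) {y : A} (r : x ≡ y) → trans (sym (p x x)) (p x y) ≡ r
    canon x refl = trans-symˡ (p x x)
    lemma : (x y : A) (r s : x ≡ y) → r ≡ s
    lemma x y r s = trans (sym (canon x r)) (canon x s)

incl : (pt : PropTrunc) → Funext → {Y : Set} → 𝓛isRosolini pt Y → 𝓛 Y
incl pt fe (P , r , φ) =
  (P , PropTrunc.∥∥-rec pt (isProp-isProp fe) (rosoliniStructure-isProp P) r , φ)

-- A D-disciplined f : X → 𝓛 Y is the same as a mere family of D-structures on the
-- domains of definition of f, i.e. an element of ∥ Π x, D (defined (f x)) ∥; countable
-- choice moves the truncation inside when X = ℕ. The Rosolini case is an instance,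
-- except that rosoliniStructure lives in Set₁ while countable choice is only available
-- for families in Set; proposition extensionality lets us choose from the small,
-- logically equivalent family Σ u, P ⇔ ⟨ u ⟩ instead.
module Submission where

open import Level using (Level)
open import Defs
open import Data.Nat using (ℕ)
open import Data.Product using (Σ; _×_; _,_; proj₁; proj₂)
open import Function using (_∘_)
open import Function.Bundles using (_⇔_; mk⇔; Equivalence)
open import Function.Construct.Composition using (_⇔-∘_)
open import Function.Construct.Identity using (⇔-id)
open import Function.Construct.Symmetry using (⇔-sym)
open import Relation.Binary.PropositionalEquality using (_≡_; cong; subst)

open Equivalence using (to; from)

𝓛-≡ : Funext → {Y : Set} (l : 𝓛 Y) (p : isProp (defined l)) → (defined l , p , value l) ≡ l
𝓛-≡ fe (P , q , φ) p = cong (λ r → (P , r , φ)) (isProp-isProp fe p q)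

rosoliniStructure⇔ : PropExt → {P : Set} → isProp P →
  rosoliniStructure P ⇔ Σ ℕ∞ (λ u → P ⇔ ⟨ proj₁ u ⟩)
rosoliniStructure⇔ pe {P} P-isProp = mk⇔
  (λ (u , P≡⟨u⟩) → u , subst (P ⇔_) P≡⟨u⟩ (⇔-id P))
  (λ (u , P⇔⟨u⟩) → u , pe P-isProp (proj₂ u) (to P⇔⟨u⟩) (from P⇔⟨u⟩))

module _ (pt : PropTrunc) where
  open PropTrunc pt

  ∥Π∥⇔Π∥∥ : CountableChoice pt → {ℓ : Level} (Y : ℕ → Set ℓ) (Y' : ℕ → Set) →
    ((n : ℕ) → Y n ⇔ Y' n) → ∥ ((n : ℕ) → Y n) ∥ ⇔ ((n : ℕ) → ∥ Y n ∥)
  ∥Π∥⇔Π∥∥ cc Y Y' Y⇔Y' = mk⇔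
    (λ ys n → ∥∥-rec ∥∥-isProp (λ y → ∣ y n ∣) ys)
    (λ ys → ∥∥-rec ∥∥-isProp (λ y' → ∣ (λ n → from (Y⇔Y' n) (y' n)) ∣)
              (cc Y' (λ n → ∥∥-rec ∥∥-isProp (∣_∣ ∘ to (Y⇔Y' n)) (ys n))))

  module _ (fe : Funext) where

    disciplined⇔∥Π∥ : {ℓ : Level} (D : Set → Set ℓ) (D-isProp : (X : Set) → D X → isProp X)
      {X Y : Set} (f : X → 𝓛 Y) →
      disciplined D D-isProp pt f ⇔ ∥ ((x : X) → D (defined (f x))) ∥
    disciplined⇔∥Π∥ D D-isProp f = mk⇔
      (∥∥-rec ∥∥-isProp λ (f' , tame-f'≡f) →
        ∣ (λ x → subst (λ g → D (defined (g x))) tame-f'≡f (proj₁ (proj₂ (f' x)))) ∣)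
      (∥∥-rec ∥∥-isProp λ ds →
        ∣ (λ x → defined (f x) , ds x , value (f x)) ,
          fe (λ x → 𝓛-≡ fe (f x) (D-isProp _ (ds x))) ∣)

    incl-factorisation⇔ : {X Y : Set} (f : X → 𝓛 Y) →
      Σ (X → 𝓛isRosolini pt Y) (λ g → incl pt fe ∘ g ≡ f)
        ⇔ ((x : X) → isRosolini pt (defined (f x)))
    incl-factorisation⇔ f = mk⇔
      (λ (g , incl∘g≡f) x → subst (λ h → isRosolini pt (defined (h x))) incl∘g≡f (proj₁ (proj₂ (g x))))
      (λ rs → (λ x → defined (f x) , rs x , value (f x)) , fe (λ x → 𝓛-≡ fe (f x) _))

theorem5p46 : (pt : PropTrunc) (fe : Funext) → PropExt → CountableChoice pt →
    ((Dom : StructuralDominance) (f : ℕ → 𝓛 ℕ) →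
    disciplined (StructuralDominance.D Dom) (StructuralDominance.D-isProp Dom) pt f
    ⇔ ((n : ℕ) → PropTrunc.∥_∥ pt (StructuralDominance.D Dom (defined (f n)))))
    × ((f : ℕ → 𝓛 ℕ) →
    disciplined rosoliniStructure rosoliniStructure-isProp pt f
    ⇔ Σ (ℕ → 𝓛isRosolini pt ℕ) (λ g → incl pt fe ∘ g ≡ f))
theorem5p46 pt fe pe cc = dominance , rosolini
  where
  dominance : (Dom : StructuralDominance) (f : ℕ → 𝓛 ℕ) →
    disciplined (StructuralDominance.D Dom) (StructuralDominance.D-isProp Dom) pt f
      ⇔ ((n : ℕ) → PropTrunc.∥_∥ pt (StructuralDominance.D Dom (defined (f n))))
  dominance Dom f =
    ∥Π∥⇔Π∥∥ pt cc D-defined D-defined (λ n → ⇔-id (D-defined n))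
      ⇔-∘ disciplined⇔∥Π∥ pt fe D D-isProp f
    where
    open StructuralDominance Dom
    D-defined : ℕ → Set
    D-defined n = D (defined (f n))

  rosolini : (f : ℕ → 𝓛 ℕ) →
    disciplined rosoliniStructure rosoliniStructure-isProp pt f
      ⇔ Σ (ℕ → 𝓛isRosolini pt ℕ) (λ g → incl pt fe ∘ g ≡ f)
  rosolini f =
    ⇔-sym (incl-factorisation⇔ pt fe f)
      ⇔-∘ (∥Π∥⇔Π∥∥ pt cc (λ n → rosoliniStructure (defined (f n))) _
             (λ n → rosoliniStructure⇔ pe (proj₁ (proj₂ (f n))))
      ⇔-∘ disciplined⇔∥Π∥ pt fe rosoliniStructure rosoliniStructure-isProp f)
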